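{- Let $m,t\ge 2$ and $r$ be integers with $m(t-1)\le r\le mt-1$, and let $n$ be a positive integer. Then there exists a graph $G\in\mathcal{G}(n,r,t)$ with $$\delta(G)=(r-1)n-(m-1)\left\lceil\frac{(r-1)n}{mt-2}\right\rceil.$$ In particular, $$f(n,r,t+1)\ge \delta(n,r,t)\ge (r-1)n-(m-1)\left\lceil\frac{(r-1)n}{mt-2}\right\rceil.$$
   Context: For positive integers $n,r$, an $r$-partite graph with parts of size $n$ is a graph $G$ whose vertex set is partitioned into $r$ independent sets $V_1,\dots,V_r$, each of size $n$. For $s\ge 2$, $f(n,r,s)$ denotes the largest minimum degree $\delta(G)$ among all $r$-partite graphs $G$ with parts of size $n$ that contain no copy of $K_{s}$. $\mathcal{G}(n,r,t)$ is the family of all $r$-partite graphs with parts of size $n$ and chromatic number at most $t$, and $\delta(n,r,t):=\max\{\delta(G): G\in\mathcal{G}(n,r,t)\}$. -}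

module Defs where

open import Data.Nat using (ℕ; zero; suc; _+_; _*_; _∸_; _≤_; _/_)
open import Data.Fin using (Fin; zero; suc)
open import Data.Bool using (Bool; true; false; if_then_else_)
open import Data.Product using (_×_; _,_; Σ; ∃; proj₁)
open import Relation.Binary.PropositionalEquality using (_≡_; _≢_)

-- Ceiling division ⌈ a / b ⌉ for b ≥ 1 (set to 0 for b = 0, never used).
ceilDiv : ℕ → ℕ → ℕ
ceilDiv a zero    = 0
ceilDiv a (suc b) = (a + b) / suc b

sumFin : (k : ℕ) → (Fin k → ℕ) → ℕ
sumFin zero    f = 0
sumFin (suc k) f = f zero + sumFin k (λ i → f (suc i))

-- Vertices of an r-partite graph with parts of size n:
-- (i , j) is the j-th vertex of part V_i.
Vtx : ℕ → ℕ → Set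
Vtx r n = Fin r × Fin n

record MultipartiteGraph (n r : ℕ) : Set where
  field
    adj        : Vtx r n → Vtx r n → Bool
    symmetric  : ∀ u v → adj u v ≡ adj v u
    irreflexive : ∀ v → adj v v ≡ false
    partsIndependent : ∀ u v → proj₁ u ≡ proj₁ v → adj u v ≡ false
open MultipartiteGraph public

Adjacent : ∀ {n r} → MultipartiteGraph n r → Vtx r n → Vtx r n → Set
Adjacent G u v = adj G u v ≡ true

degree : ∀ {n r} → MultipartiteGraph n r → Vtx r n → ℕ
degree {n} {r} G v =
  sumFin r (λ i → sumFin n (λ j → if adj G v (i , j) then 1 else 0))

MinDegreeIs : ∀ {n r} → MultipartiteGraph n r → ℕ → Set
MinDegreeIs {n} {r} G d =
  (∀ v → d ≤ degree G v) × Σ (Vtx r n) (λ v → degree G v ≡ d)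

ChromaticAtMost : ∀ {n r} → MultipartiteGraph n r → ℕ → Set
ChromaticAtMost {n} {r} G t =
  Σ (Vtx r n → Fin t) (λ c → ∀ u v → Adjacent G u v → c u ≢ c v)

InFamily : (n r t : ℕ) → MultipartiteGraph n r → Set
InFamily n r t G = ChromaticAtMost G t

HasClique : ∀ {n r} → MultipartiteGraph n r → ℕ → Set
HasClique {n} {r} G s =
  Σ (Fin s → Vtx r n) (λ f → ∀ a b → a ≢ b → Adjacent G (f a) (f b))

bound : (m r t n : ℕ) → ℕ
bound m r t n = (r ∸ 1) * n ∸ (m ∸ 1) * ceilDiv ((r ∸ 1) * n) (m * t ∸ 2)

-- Joining two vertices exactly when they lie in different parts and get different colours
-- under a t-colouring makes that colouring proper, so by pigeonhole there is no K_{t+1}, and a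
-- vertex misses exactly the vertices of its own colour outside its own part.
-- Let k = ⌈(r-1)n/(mt-2)⌉ and M = m(t-1) ≤ r.  In part i < M the first k vertices get colour
-- ⌊i/m⌋ < t-1, every other vertex gets colour t-1.  Each colour g < t-1 then has k vertices in
-- each of m parts, so its vertices have degree exactly (r-1)n - (m-1)k.  A vertex of colour t-1
-- is joined to all Mk vertices of smaller colour except at most k in its own part, and
-- (M-1)k ≥ (r-1)n - (m-1)k is precisely the choice (r-1)n ≤ (mt-2)k.

module Submission where

open import Defs
open import Data.Nat using (ℕ; suc; _*_; _∸_; _≤_)
open import Data.Product using (Σ; _×_)
open import Relation.Nullary using (¬_)

open import Data.Nat using (zero; _+_; _<_; _<?_; _≟_; z≤n; s≤s; s≤s⁻¹; NonZero; >-nonZero⁻¹)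
open import Data.Nat.Properties
open import Data.Nat.DivMod using (_/_; _%_; m*n/n≡m; m<n⇒m/n≡0; +-distrib-/-∣ˡ; m≡m%n+[m/n]*n; m%n<n; m<n*o⇒m/o<n)
open import Data.Nat.Divisibility using (n∣m*n)
open import Data.Bool using (Bool; true; false; not; _∧_; if_then_else_)
open import Data.Bool.Properties using (∧-zeroʳ)
open import Data.Fin using (Fin; zero; suc; toℕ; fromℕ<)
open import Data.Fin.Properties using (toℕ<n; toℕ-fromℕ<; pigeonhole) renaming (_≟_ to _≟ᶠ_)
import Data.Fin.Properties as Fin
open import Data.Product using (_,_; proj₁)
open import Function using (_∘_)
open import Relation.Binary.Definitions using (DecidableEquality)
open import Relation.Binary.PropositionalEquality
open import Relation.Nullary using (Dec; yes; no; does; contradiction)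
open import Relation.Nullary.Decidable using (dec-true; dec-false)
open import Algebra.Properties.CommutativeSemigroup +-commutativeSemigroup using (interchange; x∙yz≈y∙xz; x∙yz≈z∙xy)

𝟙 : Bool → ℕ
𝟙 b = if b then 1 else 0

𝟙-not+𝟙 : ∀ b → 𝟙 (not b) + 𝟙 b ≡ 1
𝟙-not+𝟙 true  = refl
𝟙-not+𝟙 false = refl

⟦_⟧ : ∀ {A : Set} → Dec A → ℕ
⟦ a? ⟧ = 𝟙 (does a?)

𝟙≤1 : ∀ b → 𝟙 b ≤ 1
𝟙≤1 true  = ≤-refl
𝟙≤1 false = z≤n

m+n∸2≡[m∸1]+[n∸1] : ∀ {m n} → 1 ≤ m → 1 ≤ n → m + n ∸ 2 ≡ (m ∸ 1) + (n ∸ 1)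
m+n∸2≡[m∸1]+[n∸1] {suc m} {suc n} _ _ = cong (_∸ 1) (+-suc m n)

ceilDiv-lower : ∀ a {d} → 1 ≤ d → a ≤ ceilDiv a d * d
ceilDiv-lower a {suc d} _ = +-cancelʳ-≤ d a _ (begin
  a + d                             ≡⟨ m≡m%n+[m/n]*n (a + d) (suc d) ⟩
  (a + d) % suc d + q * suc d       ≤⟨ +-monoˡ-≤ (q * suc d) (s≤s⁻¹ (m%n<n (a + d) (suc d))) ⟩
  d + q * suc d                     ≡⟨ +-comm d _ ⟩
  q * suc d + d                     ∎)
  where
  open ≤-Reasoning
  q : ℕ
  q = (a + d) / suc d

ceilDiv-least : ∀ a {d N} → 1 ≤ d → a ≤ N * d → ceilDiv a d ≤ N
ceilDiv-least a {suc d} {N} _ a≤Nd = s≤s⁻¹ (m<n*o⇒m/o<n (begin-strict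
  a + d              ≤⟨ +-monoˡ-≤ d a≤Nd ⟩
  N * suc d + d      <⟨ +-monoʳ-< (N * suc d) (n<1+n d) ⟩
  N * suc d + suc d  ≡⟨ +-comm (N * suc d) _ ⟩
  suc N * suc d      ∎))
  where open ≤-Reasoning

ceilDiv-pos : ∀ {a d} → 1 ≤ a → 1 ≤ d → 1 ≤ ceilDiv a d
ceilDiv-pos {a} {d} 1≤a 1≤d with ceilDiv a d | ceilDiv-lower a 1≤d
... | zero  | a≤0 = contradiction (≤-trans 1≤a a≤0) λ ()
... | suc _ | _   = s≤s z≤n

does-sym : ∀ {A : Set} (_≟′_ : DecidableEquality A) x y → does (x ≟′ y) ≡ does (y ≟′ x)
does-sym _≟′_ x y with x ≟′ y
... | yes x≡y = sym (dec-true (y ≟′ x) (sym x≡y))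
... | no  x≢y = sym (dec-false (y ≟′ x) (x≢y ∘ sym))

sumFin-cong : ∀ k {f g : Fin k → ℕ} → (∀ i → f i ≡ g i) → sumFin k f ≡ sumFin k g
sumFin-cong zero    f≗g = refl
sumFin-cong (suc k) f≗g = cong₂ _+_ (f≗g zero) (sumFin-cong k (f≗g ∘ suc))

sumFin-const : ∀ k c → sumFin k (λ _ → c) ≡ k * c
sumFin-const zero    c = refl
sumFin-const (suc k) c = cong (c +_) (sumFin-const k c)

sumFin-zero : ∀ k → sumFin k (λ _ → 0) ≡ 0
sumFin-zero k = trans (sumFin-const k 0) (*-zeroʳ k)

sumFin-distrib-+ : ∀ k (f g : Fin k → ℕ) → sumFin k (λ i → f i + g i) ≡ sumFin k f + sumFin k g
sumFin-distrib-+ zero    f g = refl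
sumFin-distrib-+ (suc k) f g =
  trans (cong (f zero + g zero +_) (sumFin-distrib-+ k (f ∘ suc) (g ∘ suc)))
        (interchange (f zero) (g zero) _ _)

sumFin-*ˡ : ∀ k c (f : Fin k → ℕ) → sumFin k (λ i → c * f i) ≡ c * sumFin k f
sumFin-*ˡ zero    c f = sym (*-zeroʳ c)
sumFin-*ˡ (suc k) c f =
  trans (cong (c * f zero +_) (sumFin-*ˡ k c (f ∘ suc))) (sym (*-distribˡ-+ c (f zero) _))

sumFin-*ʳ : ∀ k c (f : Fin k → ℕ) → sumFin k (λ i → f i * c) ≡ sumFin k f * c
sumFin-*ʳ k c f =
  trans (sumFin-cong k (λ i → *-comm (f i) c)) (trans (sumFin-*ˡ k c f) (*-comm c _))

sumFin-select : ∀ r (a : Fin (suc r)) (f : Fin (suc r) → ℕ) y →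
  sumFin (suc r) (λ i → if does (a ≟ᶠ i) then f i else y) ≡ f a + r * y
sumFin-select zero    zero    f y = refl
sumFin-select (suc r) zero    f y = cong (f zero +_) (sumFin-const (suc r) y)
sumFin-select (suc r) (suc a) f y =
  trans (cong (y +_) (sumFin-select r a (f ∘ suc) y)) (x∙yz≈y∙xz y (f (suc a)) (r * y))

sumBelow : ℕ → (ℕ → ℕ) → ℕ
sumBelow k F = sumFin k (F ∘ toℕ)

sumBelow-*ˡ : ∀ k c (F : ℕ → ℕ) → sumBelow k (λ x → c * F x) ≡ c * sumBelow k F
sumBelow-*ˡ k c F = sumFin-*ˡ k c (F ∘ toℕ)

sumBelow-cong : ∀ k {F G : ℕ → ℕ} → (∀ x → x < k → F x ≡ G x) → sumBelow k F ≡ sumBelow k G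
sumBelow-cong k F≗G = sumFin-cong k (λ i → F≗G (toℕ i) (toℕ<n i))

sumBelow-split : ∀ a b (F : ℕ → ℕ) → sumBelow (a + b) F ≡ sumBelow a F + sumBelow b (λ x → F (a + x))
sumBelow-split zero    b F = refl
sumBelow-split (suc a) b F =
  trans (cong (F 0 +_) (sumBelow-split a b (F ∘ suc))) (sym (+-assoc (F 0) _ _))

sumBelow-blocks : ∀ q m (F : ℕ → ℕ) →
  sumBelow (q * m) F ≡ sumBelow q (λ h → sumBelow m (λ j → F (h * m + j)))
sumBelow-blocks zero    m F = refl
sumBelow-blocks (suc q) m F = begin
  sumBelow (m + q * m) F
    ≡⟨ sumBelow-split m (q * m) F ⟩
  sumBelow m F + sumBelow (q * m) (λ x → F (m + x))
    ≡⟨ cong (sumBelow m F +_) (sumBelow-blocks q m (λ x → F (m + x))) ⟩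
  sumBelow m F + sumBelow q (λ h → sumBelow m (λ j → F (m + (h * m + j))))
    ≡⟨ cong (sumBelow m F +_) (sumFin-cong q λ h → sumFin-cong m λ j → cong F (sym (+-assoc m _ _))) ⟩
  sumBelow (suc q) (λ h → sumBelow m (λ j → F (h * m + j)))
    ∎
  where open ≡-Reasoning

sumBelow-truncate : ∀ {M r} → M ≤ r → (F : ℕ → ℕ) →
  sumBelow r (λ x → ⟦ x <? M ⟧ * F x) ≡ sumBelow M F
sumBelow-truncate {M} {r} M≤r F = begin
  sumBelow r G
    ≡⟨ cong (λ r → sumBelow r G) (sym (m+[n∸m]≡n M≤r)) ⟩
  sumBelow (M + (r ∸ M)) G
    ≡⟨ sumBelow-split M (r ∸ M) G ⟩
  sumBelow M G + sumBelow (r ∸ M) (λ x → G (M + x))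
    ≡⟨ cong₂ _+_ (sumBelow-cong M below) (trans (sumFin-cong (r ∸ M) above) (sumFin-zero (r ∸ M))) ⟩
  sumBelow M F + 0
    ≡⟨ +-identityʳ _ ⟩
  sumBelow M F
    ∎
  where
  open ≡-Reasoning
  G : ℕ → ℕ
  G x = ⟦ x <? M ⟧ * F x
  below : ∀ x → x < M → G x ≡ F x
  below x x<M rewrite dec-true (x <? M) x<M = +-identityʳ (F x)
  above : ∀ i → G (M + toℕ i) ≡ 0
  above i rewrite dec-false (M + toℕ i <? M) (m+n≮m M (toℕ i)) = refl

sumBelow-< : ∀ {k n} → k ≤ n → sumBelow n (λ y → ⟦ y <? k ⟧) ≡ k
sumBelow-< {k} {n} k≤n = begin
  sumBelow n (λ y → ⟦ y <? k ⟧)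
    ≡⟨ sumFin-cong n (λ i → sym (*-identityʳ _)) ⟩
  sumBelow n (λ y → ⟦ y <? k ⟧ * 1)
    ≡⟨ sumBelow-truncate k≤n (λ _ → 1) ⟩
  sumBelow k (λ _ → 1)
    ≡⟨ sumFin-const k 1 ⟩
  k * 1
    ≡⟨ *-identityʳ k ⟩
  k
    ∎
  where open ≡-Reasoning

sumBelow-≟ : ∀ {h q} → h < q → sumBelow q (λ g → ⟦ h ≟ g ⟧) ≡ 1
sumBelow-≟ {zero}  {suc q} _         = cong suc (sumFin-zero q)
sumBelow-≟ {suc h} {suc q} (s≤s h<q) = sumBelow-≟ h<q

colourGraph : ∀ {n r} → (Vtx r n → ℕ) → MultipartiteGraph n r
colourGraph c = record
  { adj              = λ u v → not (does (proj₁ u ≟ᶠ proj₁ v)) ∧ not (does (c u ≟ c v))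
  ; symmetric        = λ u v → cong₂ (λ p q → not p ∧ not q)
                                     (does-sym _≟ᶠ_ (proj₁ u) (proj₁ v)) (does-sym _≟_ (c u) (c v))
  ; irreflexive      = λ v → sameParts v v refl
  ; partsIndependent = sameParts
  }
  where
  sameParts : ∀ u v → proj₁ u ≡ proj₁ v → not (does (proj₁ u ≟ᶠ proj₁ v)) ∧ not (does (c u ≟ c v)) ≡ false
  sameParts u v same rewrite dec-true (proj₁ u ≟ᶠ proj₁ v) same = refl

partClassSize : ∀ {n r} → (Vtx r n → ℕ) → Fin r → ℕ → ℕ
partClassSize {n} c i g = sumFin n (λ j → ⟦ g ≟ c (i , j) ⟧)

classSize : ∀ {n r} → (Vtx r n → ℕ) → ℕ → ℕ
classSize {r = r} c g = sumFin r (λ i → partClassSize c i g)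

colourGraph-chromatic : ∀ {n r t} (c : Vtx r n → ℕ) → (∀ v → c v < t) → ChromaticAtMost (colourGraph c) t
colourGraph-chromatic c c<t = (λ v → fromℕ< (c<t v)) , proper
  where
  proper : ∀ u v → Adjacent (colourGraph c) u v → fromℕ< (c<t u) ≢ fromℕ< (c<t v)
  proper u v uv same with trans (sym uv) (cong (not (does (proj₁ u ≟ᶠ proj₁ v)) ∧_)
                                         (cong not (dec-true (c u ≟ c v) c-same)))
    where
    c-same : c u ≡ c v
    c-same = trans (sym (toℕ-fromℕ< (c<t u))) (trans (cong toℕ same) (toℕ-fromℕ< (c<t v)))
  ... | eq = contradiction (trans eq (∧-zeroʳ _)) λ ()

chromatic⇒cliqueFree : ∀ {n r t} (G : MultipartiteGraph n r) → ChromaticAtMost G t → ¬ HasClique G (suc t)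
chromatic⇒cliqueFree {t = t} G (c , proper) (f , clique)
  with i , j , i<j , same ← pigeonhole (n<1+n t) (c ∘ f)
  = proper (f i) (f j) (clique i j (Fin.<⇒≢ i<j)) same

degree-colourGraph : ∀ {n r} (c : Vtx (suc r) n → ℕ) v →
  degree (colourGraph c) v + classSize c (c v) ≡ partClassSize c (proj₁ v) (c v) + r * n
degree-colourGraph {n} {r} c v@(a , _) = begin
  degree (colourGraph c) v + classSize c (c v)
    ≡⟨ sym (sumFin-distrib-+ (suc r) neighboursIn (λ i → partClassSize c i (c v))) ⟩
  sumFin (suc r) (λ i → neighboursIn i + partClassSize c i (c v))
    ≡⟨ sumFin-cong (suc r) row ⟩
  sumFin (suc r) (λ i → if does (a ≟ᶠ i) then partClassSize c i (c v) else n)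
    ≡⟨ sumFin-select r a (λ i → partClassSize c i (c v)) n ⟩
  partClassSize c a (c v) + r * n
    ∎
  where
  open ≡-Reasoning
  neighboursIn : Fin (suc r) → ℕ
  neighboursIn i = sumFin n (λ j → 𝟙 (not (does (a ≟ᶠ i)) ∧ not (does (c v ≟ c (i , j)))))
  row : ∀ i → neighboursIn i + partClassSize c i (c v)
            ≡ (if does (a ≟ᶠ i) then partClassSize c i (c v) else n)
  row i with does (a ≟ᶠ i)
  ... | true  = cong (_+ partClassSize c i (c v)) (sumFin-zero n)
  ... | false = begin
    sumFin n (λ j → 𝟙 (not (does (c v ≟ c (i , j))))) + partClassSize c i (c v)
      ≡⟨ sym (sumFin-distrib-+ n _ _) ⟩
    sumFin n (λ j → 𝟙 (not (does (c v ≟ c (i , j)))) + ⟦ c v ≟ c (i , j) ⟧)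
      ≡⟨ sumFin-cong n (λ j → 𝟙-not+𝟙 (does (c v ≟ c (i , j)))) ⟩
    sumFin n (λ _ → 1)
      ≡⟨ trans (sumFin-const n 1) (*-identityʳ n) ⟩
    n
      ∎

minDegreeIs-∸ : ∀ {n r} (G : MultipartiteGraph n r) {R e} →
  (∀ v → R ≤ degree G v + e) → ∀ v₀ → degree G v₀ + e ≡ R → MinDegreeIs G (R ∸ e)
minDegreeIs-∸ G {R} {e} R≤ v₀ tight =
  (λ v → m≤n+o⇒m∸n≤o R e (≤-trans (R≤ v) (≤-reflexive (+-comm _ e)))) ,
  (v₀ , trans (sym (m+n∸n≡m _ e)) (cong (_∸ e) tight))

module BlockColouring (m t-1 k : ℕ) .{{_ : NonZero m}} where

  M : ℕ
  M = m * t-1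

  colour : ℕ → ℕ → ℕ
  colour x y = if does (x <? M) ∧ does (y <? k) then x / m else t-1

  quotient<t-1 : ∀ {x} → x < M → x / m < t-1
  quotient<t-1 {x} x<M = m<n*o⇒m/o<n (subst (x <_) (*-comm m t-1) x<M)

  quotient-block : ∀ h {j} → j < m → (h * m + j) / m ≡ h
  quotient-block h {j} j<m = begin
    (h * m + j) / m       ≡⟨ +-distrib-/-∣ˡ j (n∣m*n h) ⟩
    h * m / m + j / m     ≡⟨ cong₂ _+_ (m*n/n≡m h m) (m<n⇒m/n≡0 j<m) ⟩
    h + 0                 ≡⟨ +-identityʳ h ⟩
    h                     ∎
    where open ≡-Reasoning

  colour-<M-<k : ∀ {x y} → x < M → y < k → colour x y ≡ x / m
  colour-<M-<k {x} {y} x<M y<k rewrite dec-true (x <? M) x<M | dec-true (y <? k) y<k = refl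

  colour-≮M : ∀ {x y} → ¬ x < M → colour x y ≡ t-1
  colour-≮M {x} x≮M rewrite dec-false (x <? M) x≮M = refl

  colour-≮k : ∀ {x y} → ¬ y < k → colour x y ≡ t-1
  colour-≮k {x} {y} y≮k rewrite dec-false (y <? k) y≮k | ∧-zeroʳ (does (x <? M)) = refl

  colour≤t-1 : ∀ x y → colour x y ≤ t-1
  colour≤t-1 x y with x <? M | y <? k
  ... | yes x<M | yes y<k = ≤-trans (≤-reflexive (colour-<M-<k x<M y<k)) (<⇒≤ (quotient<t-1 x<M))
  ... | yes _   | no  y≮k = ≤-reflexive (colour-≮k y≮k)
  ... | no  x≮M | _       = ≤-reflexive (colour-≮M x≮M)

  ⟦≟colour⟧ : ∀ {g} x y → g < t-1 →
    ⟦ g ≟ colour x y ⟧ ≡ ⟦ x <? M ⟧ * ⟦ g ≟ x / m ⟧ * ⟦ y <? k ⟧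
  ⟦≟colour⟧ {g} x y g<t-1 with x <? M | y <? k
  ... | yes x<M | yes y<k rewrite dec-true (x <? M) x<M | dec-true (y <? k) y<k =
    sym (trans (*-identityʳ _) (+-identityʳ _))
  ... | yes x<M | no  y≮k rewrite dec-true (x <? M) x<M | dec-false (y <? k) y≮k
                                | dec-false (g ≟ t-1) (<⇒≢ g<t-1) = sym (*-zeroʳ (1 * ⟦ g ≟ x / m ⟧))
  ... | no  x≮M | _       rewrite dec-false (x <? M) x≮M | dec-false (g ≟ t-1) (<⇒≢ g<t-1) = refl

  ⟦t-1≟colour⟧ : ∀ x y → ⟦ t-1 ≟ colour x y ⟧ + ⟦ x <? M ⟧ * ⟦ y <? k ⟧ ≡ 1
  ⟦t-1≟colour⟧ x y with x <? M | y <? k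
  ... | yes x<M | yes y<k rewrite dec-true (x <? M) x<M | dec-true (y <? k) y<k
                                | dec-false (t-1 ≟ x / m) (>⇒≢ (quotient<t-1 x<M)) = refl
  ... | yes x<M | no  y≮k rewrite dec-true (x <? M) x<M | dec-false (y <? k) y≮k
                                | dec-true (t-1 ≟ t-1) refl = refl
  ... | no  x≮M | _       rewrite dec-false (x <? M) x≮M | dec-true (t-1 ≟ t-1) refl = refl

  partsWithColour : ∀ {g} → g < t-1 → sumBelow M (λ x → ⟦ g ≟ x / m ⟧) ≡ m
  partsWithColour {g} g<t-1 = begin
    sumBelow M (λ x → ⟦ g ≟ x / m ⟧)
      ≡⟨ cong (λ M → sumBelow M (λ x → ⟦ g ≟ x / m ⟧)) (*-comm m t-1) ⟩
    sumBelow (t-1 * m) (λ x → ⟦ g ≟ x / m ⟧)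
      ≡⟨ sumBelow-blocks t-1 m (λ x → ⟦ g ≟ x / m ⟧) ⟩
    sumBelow t-1 (λ h → sumBelow m (λ j → ⟦ g ≟ (h * m + j) / m ⟧))
      ≡⟨ sumFin-cong t-1 (λ h → sumBelow-cong m (λ j j<m → cong (λ q → ⟦ g ≟ q ⟧) (quotient-block (toℕ h) j<m))) ⟩
    sumBelow t-1 (λ h → sumBelow m (λ _ → ⟦ g ≟ h ⟧))
      ≡⟨ sumFin-cong t-1 (λ h → sumFin-const m _) ⟩
    sumBelow t-1 (λ h → m * ⟦ g ≟ h ⟧)
      ≡⟨ sumFin-*ˡ t-1 m _ ⟩
    m * sumBelow t-1 (λ h → ⟦ g ≟ h ⟧)
      ≡⟨ cong (m *_) (sumBelow-≟ g<t-1) ⟩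
    m * 1
      ≡⟨ *-identityʳ m ⟩
    m
      ∎
    where open ≡-Reasoning

  module _ {n : ℕ} (k≤n : k ≤ n) where

    partClassSize-low : ∀ {g} x → g < t-1 →
      sumBelow n (λ y → ⟦ g ≟ colour x y ⟧) ≡ ⟦ x <? M ⟧ * ⟦ g ≟ x / m ⟧ * k
    partClassSize-low {g} x g<t-1 = begin
      sumBelow n (λ y → ⟦ g ≟ colour x y ⟧)
        ≡⟨ sumFin-cong n (λ j → ⟦≟colour⟧ x (toℕ j) g<t-1) ⟩
      sumBelow n (λ y → ⟦ x <? M ⟧ * ⟦ g ≟ x / m ⟧ * ⟦ y <? k ⟧)
        ≡⟨ sumBelow-*ˡ n (⟦ x <? M ⟧ * ⟦ g ≟ x / m ⟧) (λ y → ⟦ y <? k ⟧) ⟩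
      ⟦ x <? M ⟧ * ⟦ g ≟ x / m ⟧ * sumBelow n (λ y → ⟦ y <? k ⟧)
        ≡⟨ cong (⟦ x <? M ⟧ * ⟦ g ≟ x / m ⟧ *_) (sumBelow-< k≤n) ⟩
      ⟦ x <? M ⟧ * ⟦ g ≟ x / m ⟧ * k
        ∎
      where open ≡-Reasoning

    partClassSize-top : ∀ x → sumBelow n (λ y → ⟦ t-1 ≟ colour x y ⟧) + ⟦ x <? M ⟧ * k ≡ n
    partClassSize-top x = begin
      sumBelow n (λ y → ⟦ t-1 ≟ colour x y ⟧) + ⟦ x <? M ⟧ * k
        ≡⟨ cong (λ k → sumBelow n (λ y → ⟦ t-1 ≟ colour x y ⟧) + ⟦ x <? M ⟧ * k) (sym (sumBelow-< k≤n)) ⟩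
      sumBelow n (λ y → ⟦ t-1 ≟ colour x y ⟧) + ⟦ x <? M ⟧ * sumBelow n (λ y → ⟦ y <? k ⟧)
        ≡⟨ cong (sumBelow n (λ y → ⟦ t-1 ≟ colour x y ⟧) +_) (sym (sumBelow-*ˡ n (⟦ x <? M ⟧) (λ y → ⟦ y <? k ⟧))) ⟩
      sumBelow n (λ y → ⟦ t-1 ≟ colour x y ⟧) + sumBelow n (λ y → ⟦ x <? M ⟧ * ⟦ y <? k ⟧)
        ≡⟨ sym (sumFin-distrib-+ n _ _) ⟩
      sumBelow n (λ y → ⟦ t-1 ≟ colour x y ⟧ + ⟦ x <? M ⟧ * ⟦ y <? k ⟧)
        ≡⟨ sumFin-cong n (λ j → ⟦t-1≟colour⟧ x (toℕ j)) ⟩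
      sumBelow n (λ _ → 1)
        ≡⟨ trans (sumFin-const n 1) (*-identityʳ n) ⟩
      n
        ∎
      where open ≡-Reasoning

    module _ {r : ℕ} (M≤r : M ≤ r) where

      classSize-low : ∀ {g} → g < t-1 → sumBelow r (λ x → sumBelow n (λ y → ⟦ g ≟ colour x y ⟧)) ≡ m * k
      classSize-low {g} g<t-1 = begin
        sumBelow r (λ x → sumBelow n (λ y → ⟦ g ≟ colour x y ⟧))
          ≡⟨ sumFin-cong r (λ i → partClassSize-low (toℕ i) g<t-1) ⟩
        sumBelow r (λ x → ⟦ x <? M ⟧ * ⟦ g ≟ x / m ⟧ * k)
          ≡⟨ sumFin-*ʳ r k _ ⟩
        sumBelow r (λ x → ⟦ x <? M ⟧ * ⟦ g ≟ x / m ⟧) * k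
          ≡⟨ cong (_* k) (trans (sumBelow-truncate M≤r (λ x → ⟦ g ≟ x / m ⟧)) (partsWithColour g<t-1)) ⟩
        m * k
          ∎
        where open ≡-Reasoning

      classSize-top : sumBelow r (λ x → sumBelow n (λ y → ⟦ t-1 ≟ colour x y ⟧)) + M * k ≡ r * n
      classSize-top = begin
        sumBelow r P + M * k
          ≡⟨ cong (sumBelow r P +_) (sym (trans (sumBelow-truncate M≤r (λ _ → k)) (sumFin-const M k))) ⟩
        sumBelow r P + sumBelow r (λ x → ⟦ x <? M ⟧ * k)
          ≡⟨ sym (sumFin-distrib-+ r _ _) ⟩
        sumBelow r (λ x → P x + ⟦ x <? M ⟧ * k)
          ≡⟨ sumFin-cong r (λ i → partClassSize-top (toℕ i)) ⟩
        sumBelow r (λ _ → n)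
          ≡⟨ sumFin-const r n ⟩
        r * n
          ∎
        where
        open ≡-Reasoning
        P : ℕ → ℕ
        P x = sumBelow n (λ y → ⟦ t-1 ≟ colour x y ⟧)

  module _ {n r : ℕ} where

    blockColouring : Vtx (suc r) n → ℕ
    blockColouring (i , j) = colour (toℕ i) (toℕ j)

    blockGraph : MultipartiteGraph n (suc r)
    blockGraph = colourGraph blockColouring

    module _ (k≤n : k ≤ n) (M≤r : M ≤ suc r) where

      degree-low : ∀ i j → toℕ i < M → toℕ j < k → degree blockGraph (i , j) + (m ∸ 1) * k ≡ r * n
      degree-low i j x<M y<k = +-cancelˡ-≡ k _ _ (begin
        k + (d + (m ∸ 1) * k)             ≡⟨ x∙yz≈y∙xz k d _ ⟩
        d + (k + (m ∸ 1) * k)             ≡⟨ cong (λ m′ → d + m′ * k) (m+[n∸m]≡n (>-nonZero⁻¹ m)) ⟩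
        d + m * k                         ≡⟨ cong (d +_) (sym (classSize-low k≤n M≤r c<t-1)) ⟩
        d + classSize blockColouring c    ≡⟨ degree-colourGraph blockColouring (i , j) ⟩
        partClassSize blockColouring i c + r * n  ≡⟨ cong (_+ r * n) ownPart ⟩
        k + r * n                         ∎)
        where
        open ≡-Reasoning
        d c : ℕ
        d = degree blockGraph (i , j)
        c = colour (toℕ i) (toℕ j)
        c≡ : c ≡ toℕ i / m
        c≡ = colour-<M-<k x<M y<k
        c<t-1 : c < t-1
        c<t-1 = subst (_< t-1) (sym c≡) (quotient<t-1 x<M)
        ownIndicators : ⟦ toℕ i <? M ⟧ * ⟦ c ≟ toℕ i / m ⟧ * k ≡ k
        ownIndicators rewrite dec-true (c ≟ toℕ i / m) c≡ | dec-true (toℕ i <? M) x<M = +-identityʳ k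
        ownPart : partClassSize blockColouring i c ≡ k
        ownPart = trans (partClassSize-low k≤n (toℕ i) c<t-1) ownIndicators

      degree-top : ∀ i j → colour (toℕ i) (toℕ j) ≡ t-1 → (M ∸ 1) * k ≤ degree blockGraph (i , j)
      degree-top i j c≡t-1 = begin
        (M ∸ 1) * k    ≡⟨ *-distribʳ-∸ k M 1 ⟩
        M * k ∸ 1 * k  ≤⟨ ∸-monoʳ-≤ (M * k) (*-monoˡ-≤ k (𝟙≤1 (does (toℕ i <? M)))) ⟩
        M * k ∸ s      ≡⟨ cong (_∸ s) (sym d+s) ⟩
        d + s ∸ s      ≡⟨ m+n∸n≡m d s ⟩
        d              ∎
        where
        open ≤-Reasoning
        d s C P : ℕ
        d = degree blockGraph (i , j)
        s = ⟦ toℕ i <? M ⟧ * k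
        C = classSize blockColouring t-1
        P = partClassSize blockColouring i t-1
        d+C : d + C ≡ P + r * n
        d+C = subst (λ g → d + classSize blockColouring g ≡ partClassSize blockColouring i g + r * n)
                    c≡t-1 (degree-colourGraph blockColouring (i , j))
        d+s : d + s ≡ M * k
        d+s = +-cancelʳ-≡ (n + r * n) _ _ (begin-equality
          d + s + (n + r * n)      ≡⟨ cong (d + s +_) (sym (classSize-top k≤n M≤r)) ⟩
          d + s + (C + M * k)      ≡⟨ interchange d s C (M * k) ⟩
          d + C + (s + M * k)      ≡⟨ cong (_+ (s + M * k)) d+C ⟩
          P + r * n + (s + M * k)  ≡⟨ interchange P (r * n) s (M * k) ⟩
          P + s + (r * n + M * k)  ≡⟨ cong (_+ (r * n + M * k)) (partClassSize-top k≤n (toℕ i)) ⟩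
          n + (r * n + M * k)      ≡⟨ x∙yz≈z∙xy n (r * n) (M * k) ⟩
          M * k + (n + r * n)      ∎)

      blockGraph-minDegree : 1 ≤ t-1 → 1 ≤ k → r * n ≤ (m * suc t-1 ∸ 2) * k →
        MinDegreeIs blockGraph (r * n ∸ (m ∸ 1) * k)
      blockGraph-minDegree 1≤t-1 1≤k rn≤Dk =
        minDegreeIs-∸ blockGraph lower (zero , j₀) (degree-low zero j₀ 0<M j₀<k)
        where
        0<M : 0 < M
        0<M = *-mono-≤ (>-nonZero⁻¹ m) 1≤t-1
        j₀ : Fin n
        j₀ = fromℕ< (≤-trans 1≤k k≤n)
        j₀<k : toℕ j₀ < k
        j₀<k = subst (_< k) (sym (toℕ-fromℕ< (≤-trans 1≤k k≤n))) 1≤k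
        top : ∀ i j → colour (toℕ i) (toℕ j) ≡ t-1 → r * n ≤ degree blockGraph (i , j) + (m ∸ 1) * k
        top i j c≡t-1 = begin
          r * n                      ≤⟨ rn≤Dk ⟩
          (m * suc t-1 ∸ 2) * k      ≡⟨ cong (λ mt → (mt ∸ 2) * k) (*-suc m t-1) ⟩
          (m + M ∸ 2) * k            ≡⟨ cong (_* k) (m+n∸2≡[m∸1]+[n∸1] (>-nonZero⁻¹ m) 0<M) ⟩
          ((m ∸ 1) + (M ∸ 1)) * k    ≡⟨ *-distribʳ-+ k (m ∸ 1) (M ∸ 1) ⟩
          (m ∸ 1) * k + (M ∸ 1) * k  ≤⟨ +-monoʳ-≤ ((m ∸ 1) * k) (degree-top i j c≡t-1) ⟩
          (m ∸ 1) * k + d            ≡⟨ +-comm ((m ∸ 1) * k) d ⟩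
          d + (m ∸ 1) * k            ∎
          where
          open ≤-Reasoning
          d : ℕ
          d = degree blockGraph (i , j)
        lower : ∀ v → r * n ≤ degree blockGraph v + (m ∸ 1) * k
        lower (i , j) with toℕ i <? M | toℕ j <? k
        ... | yes x<M | yes y<k = ≤-reflexive (sym (degree-low i j x<M y<k))
        ... | yes _   | no  y≮k = top i j (colour-≮k y≮k)
        ... | no  x≮M | _       = top i j (colour-≮M x≮M)

proposition4p1 : (m t r n : ℕ) → 2 ≤ m → 2 ≤ t → m * (t ∸ 1) ≤ r → r ≤ m * t ∸ 1 → 1 ≤ n →
    Σ (MultipartiteGraph n r) (λ G →
      InFamily n r t G × MinDegreeIs G (bound m r t n) × ¬ HasClique G (suc t))
proposition4p1 _ (suc zero) _ _ _ (s≤s ()) _ _ _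
proposition4p1 (suc _) (suc (suc _)) zero _ _ _ () _ _
proposition4p1 m@(suc _) t@(suc t-1) (suc r) n 2≤m 2≤t M≤r r≤mt-1 1≤n =
  blockGraph , χ≤t , blockGraph-minDegree k≤n M≤r 1≤t-1 1≤k rn≤Dk , chromatic⇒cliqueFree blockGraph χ≤t
  where
  D k : ℕ
  D = m * t ∸ 2
  k = ceilDiv (r * n) D
  open BlockColouring m t-1 k
  χ≤t : ChromaticAtMost blockGraph t
  χ≤t = colourGraph-chromatic blockColouring (λ (i , j) → s≤s (colour≤t-1 (toℕ i) (toℕ j)))
  1≤t-1 : 1 ≤ t-1
  1≤t-1 = s≤s⁻¹ 2≤t
  1≤r : 1 ≤ r
  1≤r = s≤s⁻¹ (≤-trans (*-mono-≤ 2≤m 1≤t-1) M≤r)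
  r≤D : r ≤ D
  r≤D = subst (r ≤_) (∸-+-assoc (m * t) 1 1) (∸-monoˡ-≤ 1 r≤mt-1)
  1≤D : 1 ≤ D
  1≤D = ≤-trans 1≤r r≤D
  rn≤Dk : r * n ≤ D * k
  rn≤Dk = subst (r * n ≤_) (*-comm k D) (ceilDiv-lower (r * n) 1≤D)
  k≤n : k ≤ n
  k≤n = ceilDiv-least (r * n) 1≤D (subst (r * n ≤_) (*-comm D n) (*-monoˡ-≤ n r≤D))
  1≤k : 1 ≤ k
  1≤k = ceilDiv-pos (*-mono-≤ 1≤r 1≤n) 1≤D
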